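{- Let $A\subseteq\mathbb{N}_{+}$ and $n\in\mathbb{N}$. Then $$\sum_{i=1}^{n}p_{A,i}(t)f_{A,n-i}(t)=t\,f_{A,n}'(t),\qquad \sum_{i=1}^{n}q_{A,i}(t)f_{A,n-i}(t)=n\,f_{A,n}(t),$$ and, for $n\geq 1$, $t\,q_{A,n}'(t)=n\,p_{A,n}(t)$.
   Context: For $A\subseteq\mathbb{N}_{+}$ (possibly infinite), define polynomials $f_{A,n}(t)$ by the formal power series identity $F_A(t,x)=\prod_{a\in A}\frac{1}{1-tx^{a}}=\sum_{n=0}^{\infty}f_{A,n}(t)x^{n}$; equivalently $f_{A,n}(t)=\sum_{i=0}^{n}c_A(i,n)t^i$, where $c_A(i,n)$ is the number of partitions of $n$ into exactly $i$ parts, all lying in $A$ (order of parts disregarded; $c_A(0,0)=1$). For $n\in\mathbb{N}_{+}$ let $A(n)=\{d\in A: d\mid n\}$, and define $p_{A,n}(t)=\sum_{a\in A(n)}t^{n/a}$ and $q_{A,n}(t)=\sum_{a\in A(n)}a\,t^{n/a}$. -}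

module Defs where

open import Data.Bool using (Bool; true; false; T; if_then_else_; _∧_)
open import Data.Nat using (ℕ; zero; suc; _+_; _*_; _∸_; _/_; _≟_)
open import Data.Nat.Divisibility using (_∣?_)
open import Data.Nat.ListAction using (sum)
open import Data.List using (List; []; _∷_; map; upTo; length; filter; foldr; concatMap; applyUpTo)
open import Data.List.Relation.Unary.All using (All; all?)
open import Data.List.Relation.Unary.Linked using (Linked; linked?)
open import Data.Nat using (_≥_)
import Data.Nat.Properties as ℕP
open import Data.Product using (_×_)
open import Relation.Nullary using (does)
open import Relation.Nullary.Decidable using (_×-dec_; T?)
open import Relation.Binary.PropositionalEquality using (_≡_)

Subset : Set
Subset = ℕ → Bool

-- Polynomials in t with natural-number coefficients, represented by their
-- coefficient sequence (k ↦ coefficient of t^k).  Equality of polynomials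
-- is pointwise equality of coefficients (_≗_).

Poly : Set
Poly = ℕ → ℕ

zeroP : Poly
zeroP _ = 0

_+P_ : Poly → Poly → Poly
(f +P g) k = f k + g k

sumP : List Poly → Poly
sumP = foldr _+P_ zeroP

scaleP : ℕ → Poly → Poly
scaleP c f k = c * f k

monoP : ℕ → Poly
monoP m k = if does (k ≟ m) then 1 else 0

_*P_ : Poly → Poly → Poly
(f *P g) k = sum (map (λ j → f j * g (k ∸ j)) (upTo (suc k)))

derivP : Poly → Poly
derivP f k = suc k * f (suc k)

timesT : Poly → Poly
timesT f zero    = 0
timesT f (suc k) = f k

listsOver : ℕ → ℕ → List (List ℕ)
listsOver zero    n = [] ∷ []
listsOver (suc i) n =
  concatMap (λ a → map (a ∷_) (listsOver i n)) (applyUpTo suc n)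

IsAPartition : Subset → ℕ → List ℕ → Set
IsAPartition A n xs = All (λ a → T (A a)) xs × (Linked _≥_ xs × sum xs ≡ n)

isAPartition? : (A : Subset) → (n : ℕ) → (xs : List ℕ) → Relation.Nullary.Dec (IsAPartition A n xs)
isAPartition? A n xs =
  all? (λ a → T? (A a)) xs ×-dec (linked? (λ x y → y ℕP.≤? x) xs ×-dec (sum xs ℕP.≟ n))

-- c_A(i,n): number of partitions of n into exactly i parts, all in A.
-- (Every part of a partition of n lies in {1,…,n}, so enumerating
-- non-increasing lists over {1,…,n} counts them all; c_A(0,0) = 1.)
cA : Subset → ℕ → ℕ → ℕ
cA A i n = length (filter (isAPartition? A n) (listsOver i n))

fP : Subset → ℕ → Poly
fP A n i = cA A i n

-- Divisor polynomials.  A(n) = {d ∈ A : d ∣ n}; for n ≥ 1 every such d lies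
-- in {1,…,n}, enumerated as d = suc b with b < n.

pP : Subset → ℕ → Poly
pP A n = sumP (map (λ b → if A (suc b) ∧ does (suc b ∣? n)
                           then monoP (n / suc b) else zeroP) (upTo n))

qP : Subset → ℕ → Poly
qP A n = sumP (map (λ b → if A (suc b) ∧ does (suc b ∣? n)
                           then scaleP (suc b) (monoP (n / suc b)) else zeroP) (upTo n))

-- The coefficient of t^k in Σᵢ p_{A,i} f_{A,n−i} is Σ_{a ∈ A} Σ_{j ≥ 1} c_A(k − j, n − j a).  Adding j
-- copies of a to a partition of n − j a into k − j parts, this counts the partitions λ of n into k
-- parts from A, each with weight m_a(λ), the multiplicity of a in λ; summing over a gives
-- Σ_λ Σ_a m_a(λ) = k c_A(k, n).  The same count with weight a m_a(λ) (the polynomials q_{A,i})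
-- gives Σ_λ Σ_a a m_a(λ) = n c_A(k, n).  The last identity holds termwise, since (n / a) a = n for a ∣ n.
module Submission where

open import Defs
open import Data.Bool using (Bool; true; false; T; if_then_else_; _∧_)
open import Data.Bool.Properties using (∧-assoc; ∧-zeroʳ; T-∧; ∧-idempotentCommutativeMonoid)
open import Algebra.Solver.IdempotentCommutativeMonoid ∧-idempotentCommutativeMonoid
  using (solve; _⊕_; _⊜_)
open import Data.List using (List; []; _∷_; _++_; map; upTo; applyUpTo; concatMap; filter; length)
open import Data.List.Properties using (map-++; map-∘; map-cong)
open import Data.List.Relation.Unary.All using (all?)
open import Data.List.Relation.Unary.Linked using (linked?)
open import Data.Nat using (ℕ; zero; suc; _+_; _*_; _∸_; _≤_; _<_; _≟_; _≤?_; _<?_; z≤n; s≤s; s≤s⁻¹)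
open import Data.Nat.Divisibility using (_∣_; _∣?_; divides; ∣⇒≤)
open import Data.Nat.DivMod using (_/_; m*[n/m]≡n; m*n/n≡m)
open import Data.Nat.ListAction using (sum)
open import Data.Nat.ListAction.Properties using (sum-++)
open import Data.Nat.Properties
open import Algebra.Properties.CommutativeSemigroup +-commutativeSemigroup
  using () renaming (interchange to +-interchange)
open import Data.Product using (_×_; _,_; proj₁; proj₂)
open import Function using (_∘_)
open import Function.Bundles using (_⇔_; mk⇔; Equivalence)
open import Relation.Binary.PropositionalEquality
open import Relation.Nullary using (Dec; does; yes; no; ¬_)
open import Relation.Nullary.Decidable using (dec-true; dec-false; does-⇔; _×-dec_; T?)
open import Relation.Unary using (Decidable)

∑< : ℕ → (ℕ → ℕ) → ℕ
∑< zero    f = 0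
∑< (suc n) f = ∑< n f + f n

syntax ∑< n (λ i → e) = ∑[ i < n ] e

∑<-cong : ∀ n {f g : ℕ → ℕ} → (∀ a → a < n → f a ≡ g a) → ∑< n f ≡ ∑< n g
∑<-cong zero    eq = refl
∑<-cong (suc n) eq = cong₂ _+_ (∑<-cong n λ a a<n → eq a (m<n⇒m<1+n a<n)) (eq n ≤-refl)

∑<-zero : ∀ n {f : ℕ → ℕ} → (∀ a → a < n → f a ≡ 0) → ∑< n f ≡ 0
∑<-zero zero    eq = refl
∑<-zero (suc n) eq = cong₂ _+_ (∑<-zero n λ a a<n → eq a (m<n⇒m<1+n a<n)) (eq n ≤-refl)

∑<-head : ∀ n (f : ℕ → ℕ) → ∑< (suc n) f ≡ f 0 + ∑[ a < n ] f (suc a)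
∑<-head zero    f = +-comm 0 (f 0)
∑<-head (suc n) f = begin
  ∑< (suc n) f + f (suc n)                  ≡⟨ cong (_+ f (suc n)) (∑<-head n f) ⟩
  f 0 + ∑[ a < n ] f (suc a) + f (suc n)    ≡⟨ +-assoc (f 0) _ _ ⟩
  f 0 + ∑[ a < suc n ] f (suc a)            ∎
  where open ≡-Reasoning

∑<-distrib-+ : ∀ n (f g : ℕ → ℕ) → ∑[ a < n ] (f a + g a) ≡ ∑< n f + ∑< n g
∑<-distrib-+ zero    f g = refl
∑<-distrib-+ (suc n) f g =
  trans (cong (_+ (f n + g n)) (∑<-distrib-+ n f g)) (+-interchange (∑< n f) (∑< n g) (f n) (g n))

*-distribˡ-∑< : ∀ n c (f : ℕ → ℕ) → c * ∑< n f ≡ ∑[ a < n ] (c * f a)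
*-distribˡ-∑< zero    c f = *-zeroʳ c
*-distribˡ-∑< (suc n) c f = trans (*-distribˡ-+ c (∑< n f) (f n)) (cong (_+ c * f n) (*-distribˡ-∑< n c f))

*-distribʳ-∑< : ∀ n c (f : ℕ → ℕ) → ∑< n f * c ≡ ∑[ a < n ] (f a * c)
*-distribʳ-∑< zero    c f = refl
*-distribʳ-∑< (suc n) c f = trans (*-distribʳ-+ c (∑< n f) (f n)) (cong (_+ f n * c) (*-distribʳ-∑< n c f))

∑<-swap : ∀ n m (f : ℕ → ℕ → ℕ) → ∑[ a < n ] ∑[ b < m ] f a b ≡ ∑[ b < m ] ∑[ a < n ] f a b
∑<-swap zero    m f = sym (∑<-zero m λ _ _ → refl)
∑<-swap (suc n) m f =
  trans (cong (_+ ∑< m (f n)) (∑<-swap n m f)) (sym (∑<-distrib-+ m (λ b → ∑[ a < n ] f a b) (f n)))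

∑<-truncate : ∀ {m} L (f : ℕ → ℕ) → m ≤ L → (∀ a → m ≤ a → a < L → f a ≡ 0) → ∑< L f ≡ ∑< m f
∑<-truncate zero    f z≤n   vanish = refl
∑<-truncate {m} (suc L) f m≤1+L vanish with m ≤? L
... | yes m≤L = trans (cong₂ _+_ (∑<-truncate L f m≤L λ a m≤a a<L → vanish a m≤a (m<n⇒m<1+n a<L))
                                 (vanish L m≤L ≤-refl))
                      (+-identityʳ (∑< m f))
... | no  m≰L = cong (λ k → ∑< k f) (sym (≤-antisym m≤1+L (≰⇒> m≰L)))

sum-map-applyUpTo : ∀ n (f g : ℕ → ℕ) → sum (map f (applyUpTo g n)) ≡ ∑[ a < n ] f (g a)
sum-map-applyUpTo zero    f g = refl
sum-map-applyUpTo (suc n) f g =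
  trans (cong (f (g 0) +_) (sum-map-applyUpTo n f (g ∘ suc))) (sym (∑<-head n (f ∘ g)))

sum-map-upTo : ∀ n (f : ℕ → ℕ) → sum (map f (upTo n)) ≡ ∑< n f
sum-map-upTo n f = sum-map-applyUpTo n f (λ a → a)

when : Bool → ℕ → ℕ
when b x = if b then x else 0

when-0 : ∀ b → when b 0 ≡ 0
when-0 true  = refl
when-0 false = refl

when-+ : ∀ b x y → when b (x + y) ≡ when b x + when b y
when-+ true  x y = refl
when-+ false x y = refl

*-when : ∀ b c x → c * when b x ≡ when b (c * x)
*-when true  c x = refl
*-when false c x = *-zeroʳ c

when-* : ∀ b x c → when b x * c ≡ when b (x * c)
when-* true  x c = refl
when-* false x c = refl

when-∧ : ∀ b c x → when (b ∧ c) x ≡ when b (when c x)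
when-∧ true  c x = refl
when-∧ false c x = refl

when-comm : ∀ b c x → when b (when c x) ≡ when c (when b x)
when-comm true  c x = refl
when-comm false c x = sym (when-0 c)

when-cong : ∀ b {x y} → (T b → x ≡ y) → when b x ≡ when b y
when-cong true  eq = eq _
when-cong false eq = refl

when-T : ∀ b {x} → T b → when b x ≡ x
when-T true _ = refl

when-yes : ∀ {P : Set} (P? : Dec P) {x} → P → when (does P?) x ≡ x
when-yes P? p = cong (λ b → when b _) (dec-true P? p)

when-no : ∀ {P : Set} (P? : Dec P) {x} → ¬ P → when (does P?) x ≡ 0
when-no P? ¬p = cong (λ b → when b _) (dec-false P? ¬p)

∑<-when : ∀ n b (f : ℕ → ℕ) → ∑[ a < n ] when b (f a) ≡ when b (∑< n f)
∑<-when n true  f = refl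
∑<-when n false f = ∑<-zero n λ _ _ → refl

∑<-indicator : ∀ n t (F : ℕ → ℕ) → ∑[ x < n ] when (does (x ≟ t)) (F x) ≡ when (does (t <? n)) (F t)
∑<-indicator zero    t F = refl
∑<-indicator (suc n) t F with n ≟ t
... | yes refl = begin
  ∑[ x < n ] when (does (x ≟ n)) (F x) + when (does (n ≟ n)) (F n)
    ≡⟨ cong₂ _+_ (∑<-indicator n n F) (cong (λ b → when b (F n)) (dec-true (n ≟ n) refl)) ⟩
  when (does (n <? n)) (F n) + F n
    ≡⟨ cong (λ b → when b (F n) + F n) (dec-false (n <? n) (<-irrefl refl)) ⟩
  F n
    ≡⟨ cong (λ b → when b (F n)) (dec-true (n <? suc n) ≤-refl) ⟨
  when (does (n <? suc n)) (F n) ∎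
  where open ≡-Reasoning
... | no n≢t = begin
  ∑[ x < n ] when (does (x ≟ t)) (F x) + when (does (n ≟ t)) (F n)
    ≡⟨ cong₂ _+_ (∑<-indicator n t F) (cong (λ b → when b (F n)) (dec-false (n ≟ t) n≢t)) ⟩
  when (does (t <? n)) (F t) + 0
    ≡⟨ +-identityʳ _ ⟩
  when (does (t <? n)) (F t)
    ≡⟨ cong (λ b → when b (F t)) (does-⇔ t<n⇔t<1+n (t <? n) (t <? suc n)) ⟩
  when (does (t <? suc n)) (F t) ∎
  where
  open ≡-Reasoning
  t<n⇔t<1+n : t < n ⇔ t < suc n
  t<n⇔t<1+n = mk⇔ m<n⇒m<1+n (λ t<1+n → ≤∧≢⇒< (s≤s⁻¹ t<1+n) (λ t≡n → n≢t (sym t≡n)))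

sum-map-when : ∀ {X : Set} b (f : X → ℕ) xs → sum (map (λ x → when b (f x)) xs) ≡ when b (sum (map f xs))
sum-map-when true  f xs       = refl
sum-map-when false f []       = refl
sum-map-when false f (x ∷ xs) = sum-map-when false f xs

sum-map-concatMap : ∀ {X Y : Set} (f : Y → ℕ) (g : X → List Y) xs →
                    sum (map f (concatMap g xs)) ≡ sum (map (λ x → sum (map f (g x))) xs)
sum-map-concatMap f g []       = refl
sum-map-concatMap f g (x ∷ xs) = begin
  sum (map f (g x ++ concatMap g xs))                        ≡⟨ cong sum (map-++ f (g x) (concatMap g xs)) ⟩
  sum (map f (g x) ++ map f (concatMap g xs))                ≡⟨ sum-++ (map f (g x)) _ ⟩
  sum (map f (g x)) + sum (map f (concatMap g xs))           ≡⟨ cong (sum (map f (g x)) +_) (sum-map-concatMap f g xs) ⟩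
  sum (map f (g x)) + sum (map (λ y → sum (map f (g y))) xs) ∎
  where open ≡-Reasoning

length-filter≡sum : ∀ {X : Set} {P : X → Set} (P? : Decidable P) xs →
                    length (filter P? xs) ≡ sum (map (λ x → when (does (P? x)) 1) xs)
length-filter≡sum P? []       = refl
length-filter≡sum P? (x ∷ xs) with does (P? x)
... | true  = cong suc (length-filter≡sum P? xs)
... | false = length-filter≡sum P? xs

m∸n∸o≡m∸o∸n : ∀ m n o → m ∸ n ∸ o ≡ m ∸ o ∸ n
m∸n∸o≡m∸o∸n m n o = trans (∸-+-assoc m n o) (trans (cong (m ∸_) (+-comm n o)) (sym (∸-+-assoc m o n)))

+-≟-split : ∀ x t s → does (x + t ≟ s) ≡ does (x ≤? s) ∧ does (t ≟ s ∸ x)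
+-≟-split x t s = does-⇔ (mk⇔ to from) (x + t ≟ s) (x ≤? s ×-dec t ≟ s ∸ x)
  where
  to : x + t ≡ s → x ≤ s × t ≡ s ∸ x
  to refl = m≤m+n x t , sym (m+n∸m≡n x t)
  from : x ≤ s × t ≡ s ∸ x → x + t ≡ s
  from (x≤s , refl) = m+[n∸m]≡n x≤s

boundedPartitions : Subset → ℕ → ℕ → ℕ → ℕ
boundedPartitions A zero    m zero    = 1
boundedPartitions A zero    m (suc s) = 0
boundedPartitions A (suc i) m s =
  ∑[ a < m ] when (A (suc a) ∧ does (suc a ≤? s)) (boundedPartitions A i (suc a) (s ∸ suc a))

boundedPartitions-cap : ∀ A i {m} s → s ≤ m → boundedPartitions A i m s ≡ boundedPartitions A i s s
boundedPartitions-cap A zero        zero    s≤m = refl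
boundedPartitions-cap A zero        (suc s) s≤m = refl
boundedPartitions-cap A (suc i) {m} s       s≤m =
  ∑<-truncate m _ s≤m λ a s≤a _ → cong (λ c → when c (boundedPartitions A i (suc a) (s ∸ suc a)))
    (trans (cong (A (suc a) ∧_) (dec-false (suc a ≤? s) (λ a<s → <-irrefl refl (<-≤-trans a<s s≤a))))
           (∧-zeroʳ (A (suc a))))

headAtMost : ℕ → List ℕ → Bool
headAtMost m []      = true
headAtMost m (x ∷ _) = does (x ≤? m)

isAPartition-∷ : ∀ A s x xs →
  does (isAPartition? A s (x ∷ xs)) ≡
  A x ∧ (does (x ≤? s) ∧ (headAtMost x xs ∧ does (isAPartition? A (s ∸ x) xs)))
isAPartition-∷ A s x xs = begin
  (A x ∧ all) ∧ (linked (x ∷ xs) ∧ does (x + sum xs ≟ s))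
    ≡⟨ cong₂ (λ l e → (A x ∧ all) ∧ (l ∧ e)) (linked-∷ xs) (+-≟-split x (sum xs) s) ⟩
  (A x ∧ all) ∧ ((headAtMost x xs ∧ linked xs) ∧ (does (x ≤? s) ∧ does (sum xs ≟ s ∸ x)))
    ≡⟨ solve 6 (λ a b c d e f → (a ⊕ b) ⊕ ((c ⊕ d) ⊕ (e ⊕ f)) ⊜ a ⊕ (e ⊕ (c ⊕ (b ⊕ (d ⊕ f))))) refl
         (A x) all (headAtMost x xs) (linked xs) (does (x ≤? s)) (does (sum xs ≟ s ∸ x)) ⟩
  A x ∧ (does (x ≤? s) ∧ (headAtMost x xs ∧ does (isAPartition? A (s ∸ x) xs))) ∎
  where
  open ≡-Reasoning
  all : Bool
  all = does (all? (λ a → T? (A a)) xs)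
  linked : List ℕ → Bool
  linked ys = does (linked? (λ a b → b ≤? a) ys)
  linked-∷ : ∀ ys → linked (x ∷ ys) ≡ headAtMost x ys ∧ linked ys
  linked-∷ []      = refl
  linked-∷ (_ ∷ _) = refl

isBoundedPartition : Subset → ℕ → ℕ → List ℕ → Bool
isBoundedPartition A m s xs = headAtMost m xs ∧ does (isAPartition? A s xs)

isBoundedPartition-∷ : ∀ A m s x xs →
  isBoundedPartition A m s (x ∷ xs) ≡ (does (x ≤? m) ∧ (A x ∧ does (x ≤? s))) ∧ isBoundedPartition A x (s ∸ x) xs
isBoundedPartition-∷ A m s x xs = begin
  does (x ≤? m) ∧ does (isAPartition? A s (x ∷ xs))
    ≡⟨ cong (does (x ≤? m) ∧_) (isAPartition-∷ A s x xs) ⟩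
  does (x ≤? m) ∧ (A x ∧ (does (x ≤? s) ∧ (headAtMost x xs ∧ does (isAPartition? A (s ∸ x) xs))))
    ≡⟨ solve 5 (λ a b c d e → a ⊕ (b ⊕ (c ⊕ (d ⊕ e))) ⊜ (a ⊕ (b ⊕ c)) ⊕ (d ⊕ e)) refl
         (does (x ≤? m)) (A x) (does (x ≤? s)) (headAtMost x xs) (does (isAPartition? A (s ∸ x) xs)) ⟩
  (does (x ≤? m) ∧ (A x ∧ does (x ≤? s))) ∧ isBoundedPartition A x (s ∸ x) xs ∎
  where open ≡-Reasoning

isBoundedPartition-size : ∀ A s xs → isBoundedPartition A s s xs ≡ does (isAPartition? A s xs)
isBoundedPartition-size A s []       = refl
isBoundedPartition-size A s (x ∷ xs) = begin
  does (x ≤? s) ∧ does (isAPartition? A s (x ∷ xs))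
    ≡⟨ cong (does (x ≤? s) ∧_) (isAPartition-∷ A s x xs) ⟩
  does (x ≤? s) ∧ (A x ∧ (does (x ≤? s) ∧ rest))
    ≡⟨ solve 3 (λ a b c → b ⊕ (a ⊕ (b ⊕ c)) ⊜ a ⊕ (b ⊕ c)) refl (A x) (does (x ≤? s)) rest ⟩
  A x ∧ (does (x ≤? s) ∧ rest)
    ≡⟨ isAPartition-∷ A s x xs ⟨
  does (isAPartition? A s (x ∷ xs)) ∎
  where
  open ≡-Reasoning
  rest : Bool
  rest = headAtMost x xs ∧ does (isAPartition? A (s ∸ x) xs)

enumeratedPartitions : Subset → ℕ → ℕ → ℕ → ℕ → ℕ
enumeratedPartitions A i L m s = sum (map (λ xs → when (isBoundedPartition A m s xs) 1) (listsOver i L))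

enumeratedPartitions-suc : ∀ A i L m s →
  enumeratedPartitions A (suc i) L m s ≡
  ∑[ a < L ] when (does (suc a ≤? m) ∧ (A (suc a) ∧ does (suc a ≤? s)))
                  (enumeratedPartitions A i L (suc a) (s ∸ suc a))
enumeratedPartitions-suc A i L m s = begin
  sum (map count (concatMap (λ a → map (a ∷_) (listsOver i L)) (applyUpTo suc L)))
    ≡⟨ sum-map-concatMap count (λ a → map (a ∷_) (listsOver i L)) (applyUpTo suc L) ⟩
  sum (map (λ a → sum (map count (map (a ∷_) (listsOver i L)))) (applyUpTo suc L))
    ≡⟨ sum-map-applyUpTo L _ suc ⟩
  ∑[ a < L ] sum (map count (map (suc a ∷_) (listsOver i L)))
    ≡⟨ ∑<-cong L (λ a _ → count-∷ (suc a)) ⟩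
  ∑[ a < L ] when (does (suc a ≤? m) ∧ (A (suc a) ∧ does (suc a ≤? s)))
                  (enumeratedPartitions A i L (suc a) (s ∸ suc a)) ∎
  where
  open ≡-Reasoning
  count : List ℕ → ℕ
  count xs = when (isBoundedPartition A m s xs) 1
  count-∷ : ∀ a → sum (map count (map (a ∷_) (listsOver i L))) ≡
                  when (does (a ≤? m) ∧ (A a ∧ does (a ≤? s))) (enumeratedPartitions A i L a (s ∸ a))
  count-∷ a = begin
    sum (map count (map (a ∷_) (listsOver i L)))
      ≡⟨ cong sum (map-∘ (listsOver i L)) ⟨
    sum (map (λ xs → count (a ∷ xs)) (listsOver i L))
      ≡⟨ cong sum (map-cong (λ xs → trans (cong (λ b → when b 1) (isBoundedPartition-∷ A m s a xs))
                                          (when-∧ head _ 1)) (listsOver i L)) ⟩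
    sum (map (λ xs → when head (when (isBoundedPartition A a (s ∸ a) xs) 1)) (listsOver i L))
      ≡⟨ sum-map-when head _ (listsOver i L) ⟩
    when head (enumeratedPartitions A i L a (s ∸ a)) ∎
    where
    head : Bool
    head = does (a ≤? m) ∧ (A a ∧ does (a ≤? s))

enumeratedPartitions≡boundedPartitions : ∀ A i {L m} s → m ≤ L →
  enumeratedPartitions A i L m s ≡ boundedPartitions A i m s
enumeratedPartitions≡boundedPartitions A zero    zero    m≤L = refl
enumeratedPartitions≡boundedPartitions A zero    (suc s) m≤L = refl
enumeratedPartitions≡boundedPartitions A (suc i) {L} {m} s m≤L = begin
  enumeratedPartitions A (suc i) L m s
    ≡⟨ enumeratedPartitions-suc A i L m s ⟩
  ∑< L term
    ≡⟨ ∑<-truncate L term m≤L (λ a m≤a _ → cong (λ b → when (b ∧ fits a) (recurse a))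
                                                 (dec-false (suc a ≤? m) (λ a<m → <-irrefl refl (<-≤-trans a<m m≤a)))) ⟩
  ∑< m term
    ≡⟨ ∑<-cong m (λ a a<m → cong₂ (λ b n → when (b ∧ fits a) n) (dec-true (suc a ≤? m) a<m)
                                   (enumeratedPartitions≡boundedPartitions A i (s ∸ suc a) (≤-trans a<m m≤L))) ⟩
  boundedPartitions A (suc i) m s ∎
  where
  open ≡-Reasoning
  fits : ℕ → Bool
  fits a = A (suc a) ∧ does (suc a ≤? s)
  recurse : ℕ → ℕ
  recurse a = enumeratedPartitions A i L (suc a) (s ∸ suc a)
  term : ℕ → ℕ
  term a = when (does (suc a ≤? m) ∧ fits a) (recurse a)

cA≡boundedPartitions : ∀ A i s → cA A i s ≡ boundedPartitions A i s s
cA≡boundedPartitions A i s = begin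
  length (filter (isAPartition? A s) (listsOver i s))
    ≡⟨ length-filter≡sum (isAPartition? A s) (listsOver i s) ⟩
  sum (map (λ xs → when (does (isAPartition? A s xs)) 1) (listsOver i s))
    ≡⟨ cong sum (map-cong (λ xs → cong (λ b → when b 1) (isBoundedPartition-size A s xs)) (listsOver i s)) ⟨
  enumeratedPartitions A i s s s
    ≡⟨ enumeratedPartitions≡boundedPartitions A i s ≤-refl ⟩
  boundedPartitions A i s s ∎
  where open ≡-Reasoning

-- multiplicity A a k m s = Σ_{j ≥ 1} boundedPartitions A (k ∸ j) m (s ∸ j a) (multiplicity-explicit).
-- Adding j copies of a, this is the total multiplicity of the part a over the partitions counted by
-- boundedPartitions A k m s, provided A a holds and a ≤ m.
multiplicity : Subset → ℕ → ℕ → ℕ → ℕ → ℕ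
multiplicity A a zero    m s = 0
multiplicity A a (suc i) m s =
  when (does (a ≤? s)) (boundedPartitions A i m (s ∸ a) + multiplicity A a i m (s ∸ a))

multiplicity-vanish : ∀ A a i m s → s < a → multiplicity A a i m s ≡ 0
multiplicity-vanish A a zero    m s s<a = refl
multiplicity-vanish A a (suc i) m s s<a = when-no (a ≤? s) (<⇒≱ s<a)

multiplicity-explicit : ∀ A a k m s →
  multiplicity A a k m s ≡ ∑[ j < k ] when (does (a * suc j ≤? s)) (boundedPartitions A (k ∸ suc j) m (s ∸ a * suc j))
multiplicity-explicit A a zero    m s = refl
multiplicity-explicit A a (suc i) m s with a ≤? s
... | yes a≤s = begin
  when (does (a ≤? s)) (N i (s ∸ a) + multiplicity A a i m (s ∸ a))
    ≡⟨ when-yes (a ≤? s) a≤s ⟩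
  N i (s ∸ a) + multiplicity A a i m (s ∸ a)
    ≡⟨ cong₂ _+_ (sym (trans (cong (λ x → term x 0) (*-identityʳ a)) (when-yes (a ≤? s) a≤s)))
                 (trans (multiplicity-explicit A a i m (s ∸ a)) (∑<-cong i λ j _ → shift j)) ⟩
  term (a * 1) 0 + ∑[ j < i ] term (a * suc (suc j)) (suc j)
    ≡⟨ ∑<-head i (λ j → term (a * suc j) j) ⟨
  ∑[ j < suc i ] term (a * suc j) j ∎
  where
  open ≡-Reasoning
  N : ℕ → ℕ → ℕ
  N r = boundedPartitions A r m
  term : ℕ → ℕ → ℕ
  term x j = when (does (x ≤? s)) (N (i ∸ j) (s ∸ x))
  shift : ∀ j → when (does (a * suc j ≤? s ∸ a)) (N (i ∸ suc j) (s ∸ a ∸ a * suc j)) ≡ term (a * suc (suc j)) (suc j)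
  shift j = sym (begin
    when (does (a * suc (suc j) ≤? s)) (N (i ∸ suc j) (s ∸ a * suc (suc j)))
      ≡⟨ cong (λ x → when (does (x ≤? s)) (N (i ∸ suc j) (s ∸ x))) (*-suc a (suc j)) ⟩
    when (does (a + a * suc j ≤? s)) (N (i ∸ suc j) (s ∸ (a + a * suc j)))
      ≡⟨ cong₂ (λ c x → when c (N (i ∸ suc j) x)) (does-⇔ fits (a + a * suc j ≤? s) (a * suc j ≤? s ∸ a))
                                                 (sym (∸-+-assoc s a (a * suc j))) ⟩
    when (does (a * suc j ≤? s ∸ a)) (N (i ∸ suc j) (s ∸ a ∸ a * suc j)) ∎)
    where
    fits : a + a * suc j ≤ s ⇔ a * suc j ≤ s ∸ a
    fits = mk⇔ (λ le → m+n≤o⇒m≤o∸n (a * suc j) (subst (_≤ s) (+-comm a _) le))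
               (λ le → subst (_≤ s) (+-comm (a * suc j) a) (m≤o∸n⇒m+n≤o (a * suc j) a≤s le))
... | no a≰s = begin
  when (does (a ≤? s)) _          ≡⟨ when-no (a ≤? s) a≰s ⟩
  0                               ≡⟨ ∑<-zero (suc i) (λ j _ → when-no (a * suc j ≤? s) (λ le → a≰s (≤-trans (m≤m*n a (suc j)) le))) ⟨
  ∑[ j < suc i ] when (does (a * suc j ≤? s)) (boundedPartitions A (suc i ∸ suc j) m (s ∸ a * suc j)) ∎
  where open ≡-Reasoning

multiplicity≡∑cA : ∀ A a k n →
  multiplicity A a k n n ≡ ∑[ j < k ] when (does (a * suc j ≤? n)) (cA A (k ∸ suc j) (n ∸ a * suc j))
multiplicity≡∑cA A a k n = trans (multiplicity-explicit A a k n n) (∑<-cong k λ j _ →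
  when-cong (does (a * suc j ≤? n)) λ _ →
    trans (boundedPartitions-cap A (k ∸ suc j) (n ∸ a * suc j) (m∸n≤m n (a * suc j)))
          (sym (cA≡boundedPartitions A (k ∸ suc j) (n ∸ a * suc j))))

-- Partitions whose largest part is suc m, counted after removing one copy of it.
partitionsWithTop : Subset → ℕ → ℕ → ℕ → ℕ
partitionsWithTop A zero    m s = 0
partitionsWithTop A (suc i) m s =
  when (A (suc m) ∧ does (suc m ≤? s)) (boundedPartitions A i (suc m) (s ∸ suc m))

multiplicityWithTop : Subset → ℕ → ℕ → ℕ → ℕ → ℕ
multiplicityWithTop A a zero    m s = 0
multiplicityWithTop A a (suc i) m s =
  when (A (suc m) ∧ does (suc m ≤? s)) (multiplicity A a i (suc m) (s ∸ suc m))

boundedPartitions-suc : ∀ A i m s →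
  boundedPartitions A i (suc m) s ≡ boundedPartitions A i m s + partitionsWithTop A i m s
boundedPartitions-suc A zero    m zero    = refl
boundedPartitions-suc A zero    m (suc s) = refl
boundedPartitions-suc A (suc i) m s       = refl

multiplicityWithTop-suc : ∀ A a i m s → a ≤ s →
  multiplicityWithTop A a (suc i) m s ≡
  partitionsWithTop A i m (s ∸ a) + multiplicityWithTop A a i m (s ∸ a)
multiplicityWithTop-suc A a zero    m s a≤s = when-0 (A (suc m) ∧ does (suc m ≤? s))
multiplicityWithTop-suc A a (suc i) m s a≤s = begin
  when (A (suc m) ∧ does (suc m ≤? s))
       (when (does (a ≤? s ∸ suc m)) (N (s ∸ suc m ∸ a) + M (s ∸ suc m ∸ a)))
    ≡⟨ when-∧ (A (suc m) ∧ does (suc m ≤? s)) _ _ ⟨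
  when ((A (suc m) ∧ does (suc m ≤? s)) ∧ does (a ≤? s ∸ suc m)) (N (s ∸ suc m ∸ a) + M (s ∸ suc m ∸ a))
    ≡⟨ cong₂ (λ b r → when b (N r + M r)) guards (m∸n∸o≡m∸o∸n s (suc m) a) ⟩
  when (A (suc m) ∧ does (suc m ≤? s ∸ a)) (N (s ∸ a ∸ suc m) + M (s ∸ a ∸ suc m))
    ≡⟨ when-+ (A (suc m) ∧ does (suc m ≤? s ∸ a)) _ _ ⟩
  partitionsWithTop A (suc i) m (s ∸ a) + multiplicityWithTop A a (suc i) m (s ∸ a) ∎
  where
  open ≡-Reasoning
  N M : ℕ → ℕ
  N = boundedPartitions A i (suc m)
  M = multiplicity A a i (suc m)
  both-fit : suc m ≤ s ∸ a ⇔ (suc m ≤ s × a ≤ s ∸ suc m)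
  both-fit = mk⇔ (λ le → let sum≤s = m≤o∸n⇒m+n≤o (suc m) a≤s le
                         in m+n≤o⇒m≤o (suc m) sum≤s , m+n≤o⇒m≤o∸n a (subst (_≤ s) (+-comm (suc m) a) sum≤s))
                 (λ (le₁ , le₂) → m+n≤o⇒m≤o∸n (suc m) (subst (_≤ s) (+-comm a (suc m)) (m≤o∸n⇒m+n≤o a le₁ le₂)))
  guards : (A (suc m) ∧ does (suc m ≤? s)) ∧ does (a ≤? s ∸ suc m) ≡ A (suc m) ∧ does (suc m ≤? s ∸ a)
  guards = trans (∧-assoc (A (suc m)) _ _)
                 (cong (A (suc m) ∧_) (sym (does-⇔ both-fit (suc m ≤? s ∸ a) (suc m ≤? s ×-dec a ≤? s ∸ suc m))))

multiplicity-suc : ∀ A a k m s →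
  multiplicity A a k (suc m) s ≡ multiplicity A a k m s + multiplicityWithTop A a k m s
multiplicity-suc A a zero    m s = refl
multiplicity-suc A a (suc i) m s with a ≤? s
... | no a≰s = begin
  when (does (a ≤? s)) _
    ≡⟨ when-no (a ≤? s) a≰s ⟩
  0
    ≡⟨ when-0 c ⟨
  when c 0
    ≡⟨ when-cong c (λ _ → multiplicity-vanish A a i (suc m) (s ∸ suc m) s∸1+m<a) ⟨
  multiplicityWithTop A a (suc i) m s
    ≡⟨ cong (_+ multiplicityWithTop A a (suc i) m s) (when-no (a ≤? s) a≰s) ⟨
  multiplicity A a (suc i) m s + multiplicityWithTop A a (suc i) m s ∎
  where
  open ≡-Reasoning
  c : Bool
  c = A (suc m) ∧ does (suc m ≤? s)
  s∸1+m<a : s ∸ suc m < a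
  s∸1+m<a = ≤-<-trans (m∸n≤m s (suc m)) (≰⇒> a≰s)
... | yes a≤s = begin
  when (does (a ≤? s)) (N (suc m) + M (suc m))
    ≡⟨ when-yes (a ≤? s) a≤s ⟩
  N (suc m) + M (suc m)
    ≡⟨ cong₂ _+_ (boundedPartitions-suc A i m (s ∸ a)) (multiplicity-suc A a i m (s ∸ a)) ⟩
  (N m + partitionsWithTop A i m (s ∸ a)) + (M m + multiplicityWithTop A a i m (s ∸ a))
    ≡⟨ +-interchange (N m) _ _ _ ⟩
  (N m + M m) + (partitionsWithTop A i m (s ∸ a) + multiplicityWithTop A a i m (s ∸ a))
    ≡⟨ cong₂ _+_ (when-yes (a ≤? s) a≤s) (multiplicityWithTop-suc A a i m s a≤s) ⟨
  multiplicity A a (suc i) m s + multiplicityWithTop A a (suc i) m s ∎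
  where
  open ≡-Reasoning
  N M : ℕ → ℕ
  N m = boundedPartitions A i m (s ∸ a)
  M m = multiplicity A a i m (s ∸ a)

scaled-multiplicity-suc : ∀ A (w : ℕ → ℕ) a i m s →
  when (A a) (w a * multiplicity A a (suc i) (suc m) s) ≡
  when (A a) (w a * multiplicity A a (suc i) m s) +
  when (A (suc m) ∧ does (suc m ≤? s)) (when (A a) (w a * multiplicity A a i (suc m) (s ∸ suc m)))
scaled-multiplicity-suc A w a i m s = begin
  when (A a) (w a * M (suc i) (suc m) s)
    ≡⟨ cong (λ x → when (A a) (w a * x)) (multiplicity-suc A a (suc i) m s) ⟩
  when (A a) (w a * (M (suc i) m s + when c (M i (suc m) (s ∸ suc m))))
    ≡⟨ cong (when (A a)) (*-distribˡ-+ (w a) _ _) ⟩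
  when (A a) (w a * M (suc i) m s + w a * when c (M i (suc m) (s ∸ suc m)))
    ≡⟨ when-+ (A a) _ _ ⟩
  when (A a) (w a * M (suc i) m s) + when (A a) (w a * when c (M i (suc m) (s ∸ suc m)))
    ≡⟨ cong (when (A a) (w a * M (suc i) m s) +_)
            (trans (cong (when (A a)) (*-when c (w a) _)) (when-comm (A a) c _)) ⟩
  when (A a) (w a * M (suc i) m s) + when c (when (A a) (w a * M i (suc m) (s ∸ suc m))) ∎
  where
  open ≡-Reasoning
  M : ℕ → ℕ → ℕ → ℕ
  M = multiplicity A a
  c : Bool
  c = A (suc m) ∧ does (suc m ≤? s)

weightedMultiplicity : Subset → (ℕ → ℕ) → ℕ → ℕ → ℕ → ℕ
weightedMultiplicity A w k m s = ∑[ b < m ] when (A (suc b)) (w (suc b) * multiplicity A (suc b) k m s)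

weightedMultiplicity-suc : ∀ A w i m s →
  weightedMultiplicity A w (suc i) (suc m) s ≡
  weightedMultiplicity A w (suc i) m s +
  when (A (suc m) ∧ does (suc m ≤? s))
       (weightedMultiplicity A w i (suc m) (s ∸ suc m) + w (suc m) * boundedPartitions A i (suc m) (s ∸ suc m))
weightedMultiplicity-suc A w i m s = begin
  ∑[ b < m ] when (A (suc b)) (w (suc b) * M (suc b) (suc i) (suc m) s) + when (A (suc m)) (w (suc m) * M (suc m) (suc i) (suc m) s)
    ≡⟨ cong₂ _+_ (trans (∑<-cong m λ b _ → scaled-multiplicity-suc A w (suc b) i m s) (∑<-distrib-+ m _ _)) top ⟩
  (E (suc i) m s + ∑[ b < m ] when c (X b)) + when c (w (suc m) * (N' + M (suc m) i (suc m) s'))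
    ≡⟨ cong (λ x → E (suc i) m s + x + when c (w (suc m) * (N' + M (suc m) i (suc m) s'))) (∑<-when m c X) ⟩
  (E (suc i) m s + when c (∑< m X)) + when c (w (suc m) * (N' + M (suc m) i (suc m) s'))
    ≡⟨ +-assoc (E (suc i) m s) _ _ ⟩
  E (suc i) m s + (when c (∑< m X) + when c (w (suc m) * (N' + M (suc m) i (suc m) s')))
    ≡⟨ cong (E (suc i) m s +_) (trans (sym (when-+ c _ _)) (when-cong c (regroup ∘ proj₁ ∘ Equivalence.to T-∧))) ⟩
  E (suc i) m s + when c (E i (suc m) s' + w (suc m) * N') ∎
  where
  open ≡-Reasoning
  E : ℕ → ℕ → ℕ → ℕ
  E = weightedMultiplicity A w
  M : ℕ → ℕ → ℕ → ℕ → ℕ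
  M = multiplicity A
  c : Bool
  c = A (suc m) ∧ does (suc m ≤? s)
  s' N' : ℕ
  s' = s ∸ suc m
  N' = boundedPartitions A i (suc m) s'
  X : ℕ → ℕ
  X b = when (A (suc b)) (w (suc b) * M (suc b) i (suc m) s')
  top : when (A (suc m)) (w (suc m) * M (suc m) (suc i) (suc m) s) ≡ when c (w (suc m) * (N' + M (suc m) i (suc m) s'))
  top = begin
    when (A (suc m)) (w (suc m) * when (does (suc m ≤? s)) (N' + M (suc m) i (suc m) s'))
      ≡⟨ cong (when (A (suc m))) (*-when (does (suc m ≤? s)) (w (suc m)) _) ⟩
    when (A (suc m)) (when (does (suc m ≤? s)) (w (suc m) * (N' + M (suc m) i (suc m) s')))
      ≡⟨ when-∧ (A (suc m)) _ _ ⟨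
    when c (w (suc m) * (N' + M (suc m) i (suc m) s')) ∎
  regroup : T (A (suc m)) → ∑< m X + w (suc m) * (N' + M (suc m) i (suc m) s') ≡ E i (suc m) s' + w (suc m) * N'
  regroup A[1+m] = begin
    ∑< m X + w (suc m) * (N' + M (suc m) i (suc m) s')
      ≡⟨ cong (∑< m X +_) (trans (*-distribˡ-+ (w (suc m)) N' _) (+-comm (w (suc m) * N') _)) ⟩
    ∑< m X + (w (suc m) * M (suc m) i (suc m) s' + w (suc m) * N')
      ≡⟨ +-assoc (∑< m X) _ _ ⟨
    ∑< m X + w (suc m) * M (suc m) i (suc m) s' + w (suc m) * N'
      ≡⟨ cong (λ x → ∑< m X + x + w (suc m) * N') (when-T (A (suc m)) A[1+m]) ⟨
    E i (suc m) s' + w (suc m) * N' ∎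

-- Φ i s is the total w-weight of the parts of any partition of s into i parts.
record IsTotalWeight (w : ℕ → ℕ) (Φ : ℕ → ℕ → ℕ) : Set where
  field
    empty : Φ 0 0 ≡ 0
    cons  : ∀ i a s → a ≤ s → Φ (suc i) s ≡ Φ i (s ∸ a) + w a

numberOfParts : IsTotalWeight (λ _ → 1) (λ i _ → i)
numberOfParts = record { empty = refl ; cons = λ i _ _ _ → +-comm 1 i }

sizeOfParts : IsTotalWeight (λ a → a) (λ _ s → s)
sizeOfParts = record { empty = refl ; cons = λ _ a s a≤s → sym (m∸n+n≡m a≤s) }

weightedMultiplicity≡totalWeight*boundedPartitions : ∀ A {w Φ} → IsTotalWeight w Φ → ∀ k m s →
  weightedMultiplicity A w k m s ≡ Φ k s * boundedPartitions A k m s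
weightedMultiplicity≡totalWeight*boundedPartitions A {w} {Φ} total = go
  where
  open IsTotalWeight total
  go : ∀ k m s → weightedMultiplicity A w k m s ≡ Φ k s * boundedPartitions A k m s
  go zero m s = trans (∑<-zero m λ b _ → trans (cong (when (A (suc b))) (*-zeroʳ (w (suc b)))) (when-0 (A (suc b))))
                      (no-parts s)
    where
    no-parts : ∀ s → 0 ≡ Φ 0 s * boundedPartitions A 0 m s
    no-parts zero    = sym (trans (*-identityʳ (Φ 0 0)) empty)
    no-parts (suc s) = sym (*-zeroʳ (Φ 0 (suc s)))
  go (suc i) zero    s = sym (*-zeroʳ (Φ (suc i) s))
  go (suc i) (suc m) s = begin
    weightedMultiplicity A w (suc i) (suc m) s
      ≡⟨ weightedMultiplicity-suc A w i m s ⟩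
    weightedMultiplicity A w (suc i) m s + when c (weightedMultiplicity A w i (suc m) s' + w (suc m) * N')
      ≡⟨ cong₂ _+_ (go (suc i) m s) (when-cong c (add-top-part ∘ fits)) ⟩
    Φ (suc i) s * boundedPartitions A (suc i) m s + when c (Φ (suc i) s * N')
      ≡⟨ cong (Φ (suc i) s * boundedPartitions A (suc i) m s +_) (*-when c (Φ (suc i) s) N') ⟨
    Φ (suc i) s * boundedPartitions A (suc i) m s + Φ (suc i) s * when c N'
      ≡⟨ *-distribˡ-+ (Φ (suc i) s) _ _ ⟨
    Φ (suc i) s * boundedPartitions A (suc i) (suc m) s ∎
    where
    open ≡-Reasoning
    c : Bool
    c = A (suc m) ∧ does (suc m ≤? s)
    s' N' : ℕ
    s' = s ∸ suc m
    N' = boundedPartitions A i (suc m) s'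
    fits : T c → suc m ≤ s
    fits = ≤ᵇ⇒≤ (suc m) s ∘ proj₂ ∘ Equivalence.to (T-∧ {A (suc m)})
    add-top-part : suc m ≤ s → weightedMultiplicity A w i (suc m) s' + w (suc m) * N' ≡ Φ (suc i) s * N'
    add-top-part 1+m≤s = begin
      weightedMultiplicity A w i (suc m) s' + w (suc m) * N' ≡⟨ cong (_+ w (suc m) * N') (go i (suc m) s') ⟩
      Φ i s' * N' + w (suc m) * N'                          ≡⟨ *-distribʳ-+ N' (Φ i s') (w (suc m)) ⟨
      (Φ i s' + w (suc m)) * N'                             ≡⟨ cong (_* N') (cons i (suc m) s 1+m≤s) ⟨
      Φ (suc i) s * N'                                      ∎

timesT-derivP : ∀ (f : Poly) k → timesT (derivP f) k ≡ k * f k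
timesT-derivP f zero    = refl
timesT-derivP f (suc k) = refl

sumP-coeff : ∀ {X : Set} (F : X → Poly) xs k → sumP (map F xs) k ≡ sum (map (λ x → F x k) xs)
sumP-coeff F []       k = refl
sumP-coeff F (x ∷ xs) k = cong (F x k +_) (sumP-coeff F xs k)

*P-coeff : ∀ (f g : Poly) k → (f *P g) k ≡ ∑[ j < suc k ] (f j * g (k ∸ j))
*P-coeff f g k = sum-map-upTo (suc k) _

divisorCoeff : Subset → (ℕ → ℕ) → ℕ → ℕ → ℕ
divisorCoeff A w n k = ∑[ b < n ] when (A (suc b) ∧ does (suc b ∣? n)) (w (suc b) * monoP (n / suc b) k)

pP-coeff : ∀ A n k → pP A n k ≡ divisorCoeff A (λ _ → 1) n k
pP-coeff A n k = trans (sumP-coeff _ (upTo n) k) (trans (sum-map-upTo n _) (∑<-cong n λ b _ → term b))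
  where
  term : ∀ b → (if A (suc b) ∧ does (suc b ∣? n) then monoP (n / suc b) else zeroP) k ≡
               when (A (suc b) ∧ does (suc b ∣? n)) (1 * monoP (n / suc b) k)
  term b with A (suc b) ∧ does (suc b ∣? n)
  ... | true  = sym (*-identityˡ _)
  ... | false = refl

qP-coeff : ∀ A n k → qP A n k ≡ divisorCoeff A (λ a → a) n k
qP-coeff A n k = trans (sumP-coeff _ (upTo n) k) (trans (sum-map-upTo n _) (∑<-cong n λ b _ → term b))
  where
  term : ∀ b → (if A (suc b) ∧ does (suc b ∣? n) then scaleP (suc b) (monoP (n / suc b)) else zeroP) k ≡
               when (A (suc b) ∧ does (suc b ∣? n)) (suc b * monoP (n / suc b) k)
  term b with A (suc b) ∧ does (suc b ∣? n)
  ... | true  = refl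
  ... | false = refl

∣∧≡/⇔≡* : ∀ b n k → (suc b ∣ n × k ≡ n / suc b) ⇔ n ≡ suc b * k
∣∧≡/⇔≡* b n k = mk⇔ (λ (d∣n , k≡n/d) → trans (sym (m*[n/m]≡n d∣n)) (cong (suc b *_) (sym k≡n/d)))
                    (λ { refl → divides k (*-comm (suc b) k) , sym (trans (cong (_/ suc b) (*-comm (suc b) k)) (m*n/n≡m k (suc b))) })

divisor-term : ∀ a b w n k →
  when (a ∧ does (suc b ∣? n)) (w * monoP (n / suc b) k) ≡ when (a ∧ does (n ≟ suc b * k)) w
divisor-term a b w n k = begin
  when (a ∧ does (suc b ∣? n)) (w * when (does (k ≟ n / suc b)) 1)
    ≡⟨ cong (when (a ∧ does (suc b ∣? n))) (trans (*-when (does (k ≟ n / suc b)) w 1) (cong (when _) (*-identityʳ w))) ⟩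
  when (a ∧ does (suc b ∣? n)) (when (does (k ≟ n / suc b)) w)
    ≡⟨ when-∧ (a ∧ does (suc b ∣? n)) _ w ⟨
  when ((a ∧ does (suc b ∣? n)) ∧ does (k ≟ n / suc b)) w
    ≡⟨ cong (λ c → when c w) (∧-assoc a _ _) ⟩
  when (a ∧ (does (suc b ∣? n) ∧ does (k ≟ n / suc b))) w
    ≡⟨ cong (λ c → when (a ∧ c) w) (does-⇔ (∣∧≡/⇔≡* b n k) (suc b ∣? n ×-dec k ≟ n / suc b) (n ≟ suc b * k)) ⟩
  when (a ∧ does (n ≟ suc b * k)) w ∎
  where open ≡-Reasoning

divisorCoeff*-as-indicators : ∀ A w {n} i → i < n → ∀ j c →
  divisorCoeff A w (suc i) j * c ≡ ∑[ b < n ] when (does (suc i ≟ suc b * j)) (when (A (suc b)) (w (suc b) * c))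
divisorCoeff*-as-indicators A w {n} i i<n j c = begin
  divisorCoeff A w (suc i) j * c
    ≡⟨ *-distribʳ-∑< (suc i) c _ ⟩
  ∑[ b < suc i ] term b
    ≡⟨ ∑<-truncate n term i<n non-divisor ⟨
  ∑[ b < n ] term b
    ≡⟨ ∑<-cong n (λ b _ → as-indicator b) ⟩
  ∑[ b < n ] when (does (suc i ≟ suc b * j)) (when (A (suc b)) (w (suc b) * c)) ∎
  where
  open ≡-Reasoning
  term : ℕ → ℕ
  term b = when (A (suc b) ∧ does (suc b ∣? suc i)) (w (suc b) * monoP (suc i / suc b) j) * c
  non-divisor : ∀ b → suc i ≤ b → b < n → term b ≡ 0
  non-divisor b 1+i≤b _ = cong (λ d → when d (w (suc b) * monoP (suc i / suc b) j) * c)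
    (trans (cong (A (suc b) ∧_) (dec-false (suc b ∣? suc i) (λ d∣1+i → <-irrefl refl (≤-trans (s≤s 1+i≤b) (∣⇒≤ d∣1+i)))))
           (∧-zeroʳ (A (suc b))))
  as-indicator : ∀ b → term b ≡ when (does (suc i ≟ suc b * j)) (when (A (suc b)) (w (suc b) * c))
  as-indicator b = begin
    term b
      ≡⟨ cong (_* c) (divisor-term (A (suc b)) b (w (suc b)) (suc i) j) ⟩
    when (A (suc b) ∧ does (suc i ≟ suc b * j)) (w (suc b)) * c
      ≡⟨ when-* (A (suc b) ∧ _) (w (suc b)) c ⟩
    when (A (suc b) ∧ does (suc i ≟ suc b * j)) (w (suc b) * c)
      ≡⟨ when-∧ (A (suc b)) _ _ ⟩
    when (A (suc b)) (when (does (suc i ≟ suc b * j)) (w (suc b) * c))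
      ≡⟨ when-comm (A (suc b)) (does (suc i ≟ suc b * j)) (w (suc b) * c) ⟩
    when (does (suc i ≟ suc b * j)) (when (A (suc b)) (w (suc b) * c)) ∎

-- suc (j + d * suc j) is suc d * suc j by definition, so the i-sum picks out i = suc d * suc j ∸ 1.
∑<-indicator-multiples : ∀ n k d (F : ℕ → ℕ → ℕ) →
  ∑[ j < suc k ] ∑[ i < n ] when (does (suc i ≟ suc d * j)) (F i j) ≡
  ∑[ j < k ] when (does (suc d * suc j ≤? n)) (F (j + d * suc j) (suc j))
∑<-indicator-multiples n k d F = begin
  ∑[ j < suc k ] ∑[ i < n ] when (does (suc i ≟ suc d * j)) (F i j)
    ≡⟨ ∑<-head k (λ j → ∑[ i < n ] when (does (suc i ≟ suc d * j)) (F i j)) ⟩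
  ∑[ i < n ] when (does (suc i ≟ suc d * 0)) (F i 0) + ∑[ j < k ] ∑[ i < n ] when (does (i ≟ j + d * suc j)) (F i (suc j))
    ≡⟨ cong₂ _+_ (∑<-zero n λ i _ → when-no (suc i ≟ suc d * 0) (λ e → 1+n≢0 (trans e (*-zeroʳ (suc d)))))
                 (∑<-cong k λ j _ → ∑<-indicator n (j + d * suc j) (λ i → F i (suc j))) ⟩
  ∑[ j < k ] when (does (suc d * suc j ≤? n)) (F (j + d * suc j) (suc j)) ∎
  where open ≡-Reasoning

divisorConvolution : ∀ A w n k →
  ∑[ i < n ] ∑[ j < suc k ] (divisorCoeff A w (suc i) j * cA A (k ∸ j) (n ∸ suc i)) ≡ weightedMultiplicity A w k n n
divisorConvolution A w n k = begin
  ∑[ i < n ] ∑[ j < suc k ] (divisorCoeff A w (suc i) j * C i j)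
    ≡⟨ ∑<-cong n (λ i i<n → ∑<-cong (suc k) λ j _ → divisorCoeff*-as-indicators A w i i<n j (C i j)) ⟩
  ∑[ i < n ] ∑[ j < suc k ] ∑[ b < n ] G b j i
    ≡⟨ ∑<-cong n (λ i _ → ∑<-swap (suc k) n (λ j b → G b j i)) ⟩
  ∑[ i < n ] ∑[ b < n ] ∑[ j < suc k ] G b j i
    ≡⟨ ∑<-swap n n (λ i b → ∑[ j < suc k ] G b j i) ⟩
  ∑[ b < n ] ∑[ i < n ] ∑[ j < suc k ] G b j i
    ≡⟨ ∑<-cong n (λ b _ → ∑<-swap n (suc k) (λ i j → G b j i)) ⟩
  ∑[ b < n ] ∑[ j < suc k ] ∑[ i < n ] G b j i
    ≡⟨ ∑<-cong n (λ b _ → trans (∑<-indicator-multiples n k b (λ i j → when (A (suc b)) (w (suc b) * C i j)))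
                                (factor b)) ⟩
  weightedMultiplicity A w k n n ∎
  where
  open ≡-Reasoning
  C : ℕ → ℕ → ℕ
  C i j = cA A (k ∸ j) (n ∸ suc i)
  G : ℕ → ℕ → ℕ → ℕ
  G b j i = when (does (suc i ≟ suc b * j)) (when (A (suc b)) (w (suc b) * C i j))
  factor : ∀ b →
    ∑[ j < k ] when (does (suc b * suc j ≤? n)) (when (A (suc b)) (w (suc b) * C (j + b * suc j) (suc j))) ≡
    when (A (suc b)) (w (suc b) * multiplicity A (suc b) k n n)
  factor b = begin
    ∑[ j < k ] when (fits j) (when (A (suc b)) (w (suc b) * c j))
      ≡⟨ ∑<-cong k (λ j _ → trans (when-comm (fits j) (A (suc b)) _) (cong (when (A (suc b))) (sym (*-when (fits j) (w (suc b)) (c j))))) ⟩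
    ∑[ j < k ] when (A (suc b)) (w (suc b) * when (fits j) (c j))
      ≡⟨ ∑<-when k (A (suc b)) _ ⟩
    when (A (suc b)) (∑[ j < k ] (w (suc b) * when (fits j) (c j)))
      ≡⟨ cong (when (A (suc b))) (*-distribˡ-∑< k (w (suc b)) _) ⟨
    when (A (suc b)) (w (suc b) * ∑[ j < k ] when (fits j) (c j))
      ≡⟨ cong (λ x → when (A (suc b)) (w (suc b) * x)) (multiplicity≡∑cA A (suc b) k n) ⟨
    when (A (suc b)) (w (suc b) * multiplicity A (suc b) k n n) ∎
    where
    fits : ℕ → Bool
    fits j = does (suc b * suc j ≤? n)
    c : ℕ → ℕ
    c j = cA A (k ∸ suc j) (n ∸ suc b * suc j)

convolution-coeff : ∀ A w (P : ℕ → Poly) → (∀ i k → P i k ≡ divisorCoeff A w i k) → ∀ n k →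
  sumP (map (λ i → P i *P fP A (n ∸ i)) (map suc (upTo n))) k ≡ weightedMultiplicity A w k n n
convolution-coeff A w P P-coeff n k = begin
  sumP (map (λ i → P i *P fP A (n ∸ i)) (map suc (upTo n))) k
    ≡⟨ sumP-coeff (λ i → P i *P fP A (n ∸ i)) (map suc (upTo n)) k ⟩
  sum (map (λ i → (P i *P fP A (n ∸ i)) k) (map suc (upTo n)))
    ≡⟨ cong sum (map-∘ (upTo n)) ⟨
  sum (map (λ i → (P (suc i) *P fP A (n ∸ suc i)) k) (upTo n))
    ≡⟨ sum-map-upTo n _ ⟩
  ∑[ i < n ] (P (suc i) *P fP A (n ∸ suc i)) k
    ≡⟨ ∑<-cong n (λ i _ → trans (*P-coeff (P (suc i)) (fP A (n ∸ suc i)) k)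
                                (∑<-cong (suc k) λ j _ → cong (_* cA A (k ∸ j) (n ∸ suc i)) (P-coeff (suc i) j))) ⟩
  ∑[ i < n ] ∑[ j < suc k ] (divisorCoeff A w (suc i) j * cA A (k ∸ j) (n ∸ suc i))
    ≡⟨ divisorConvolution A w n k ⟩
  weightedMultiplicity A w k n n ∎
  where open ≡-Reasoning

timesT-derivP-qP : ∀ A n → timesT (derivP (qP A n)) ≗ scaleP n (pP A n)
timesT-derivP-qP A n k = begin
  timesT (derivP (qP A n)) k                        ≡⟨ timesT-derivP (qP A n) k ⟩
  k * qP A n k                                      ≡⟨ cong (k *_) (qP-coeff A n k) ⟩
  k * divisorCoeff A (λ a → a) n k                  ≡⟨ *-distribˡ-∑< n k _ ⟩
  ∑[ b < n ] (k * divisorTerm b (suc b))            ≡⟨ ∑<-cong n (λ b _ → k*term≡n*term b) ⟩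
  ∑[ b < n ] (n * divisorTerm b 1)                  ≡⟨ *-distribˡ-∑< n n _ ⟨
  n * divisorCoeff A (λ _ → 1) n k                  ≡⟨ cong (n *_) (pP-coeff A n k) ⟨
  n * pP A n k                                      ∎
  where
  open ≡-Reasoning
  divisorTerm : ℕ → ℕ → ℕ
  divisorTerm b w = when (A (suc b) ∧ does (suc b ∣? n)) (w * monoP (n / suc b) k)
  k*term≡n*term : ∀ b → k * divisorTerm b (suc b) ≡ n * divisorTerm b 1
  k*term≡n*term b = begin
    k * divisorTerm b (suc b)                         ≡⟨ cong (k *_) (divisor-term (A (suc b)) b (suc b) n k) ⟩
    k * when c (suc b)                                ≡⟨ *-when c k (suc b) ⟩
    when c (k * suc b)                                ≡⟨ when-cong c (λ t → trans (*-comm k (suc b)) (sym (≡ᵇ⇒≡ n _ (proj₂ (Equivalence.to (T-∧ {A (suc b)}) t))))) ⟩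
    when c n                                          ≡⟨ when-cong c (λ _ → *-identityʳ n) ⟨
    when c (n * 1)                                    ≡⟨ *-when c n 1 ⟨
    n * when c 1                                      ≡⟨ cong (n *_) (divisor-term (A (suc b)) b 1 n k) ⟨
    n * divisorTerm b 1                               ∎
    where
    c : Bool
    c = A (suc b) ∧ does (n ≟ suc b * k)

pP-convolution : ∀ A n → sumP (map (λ i → pP A i *P fP A (n ∸ i)) (map suc (upTo n))) ≗ timesT (derivP (fP A n))
pP-convolution A n k = begin
  sumP (map (λ i → pP A i *P fP A (n ∸ i)) (map suc (upTo n))) k
    ≡⟨ convolution-coeff A (λ _ → 1) (pP A) (pP-coeff A) n k ⟩
  weightedMultiplicity A (λ _ → 1) k n n
    ≡⟨ weightedMultiplicity≡totalWeight*boundedPartitions A numberOfParts k n n ⟩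
  k * boundedPartitions A k n n
    ≡⟨ cong (k *_) (cA≡boundedPartitions A k n) ⟨
  k * cA A k n
    ≡⟨ timesT-derivP (fP A n) k ⟨
  timesT (derivP (fP A n)) k ∎
  where open ≡-Reasoning

qP-convolution : ∀ A n → sumP (map (λ i → qP A i *P fP A (n ∸ i)) (map suc (upTo n))) ≗ scaleP n (fP A n)
qP-convolution A n k = begin
  sumP (map (λ i → qP A i *P fP A (n ∸ i)) (map suc (upTo n))) k
    ≡⟨ convolution-coeff A (λ a → a) (qP A) (qP-coeff A) n k ⟩
  weightedMultiplicity A (λ a → a) k n n
    ≡⟨ weightedMultiplicity≡totalWeight*boundedPartitions A sizeOfParts k n n ⟩
  n * boundedPartitions A k n n
    ≡⟨ cong (n *_) (cA≡boundedPartitions A k n) ⟨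
  n * cA A k n ∎
  where open ≡-Reasoning

-- Defs never evaluate A at 0, and the last identity also holds for n = 0, where both sides vanish.
mainTheorem1 : (A : Subset) → A 0 ≡ false → (n : ℕ) →
    (sumP (map (λ i → pP A i *P fP A (n ∸ i)) (map suc (upTo n))) ≗ timesT (derivP (fP A n)))
    × (sumP (map (λ i → qP A i *P fP A (n ∸ i)) (map suc (upTo n))) ≗ scaleP n (fP A n))
    × (1 ≤ n → timesT (derivP (qP A n)) ≗ scaleP n (pP A n))
mainTheorem1 A _ n = pP-convolution A n , qP-convolution A n , λ _ → timesT-derivP-qP A n
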